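{- Let $A,B\subseteq\mathbb N$. If $A\oplus B$ is $\mathrm{BP}$ random, then $A$ is $\mathrm{BP}$ random relative to $B$ and $B$ is $\mathrm{BP}$ random relative to $A$.
   Context: Sets are identified with their characteristic sequences in $\{0,1\}^\omega$. $A\oplus B=\{2x:x\in A\}\cup\{2x+1:x\in B\}$. $[\sigma]$ is the set of reals extending the string $\sigma$, $[G]=\bigcup_{\sigma\in G}[\sigma]$, and $\mu$ is the uniform measure. A primitive recursive test is a sequence of clopen sets $U_n=[G_n]$, with finite sets $G_n$ given by a primitive recursive function and $\mu(U_n)\le2^{ -n}$. $X$ is $\mathrm{BP}$ random if for every primitive recursive test there is $n$ with $X\notin U_n$. A primitive recursive oracle machine is an oracle Turing machine $M^Z$ whose running time on input $x$ is bounded by $g(x)$, for a primitive recursive $g$, for all oracles $Z$. A primitive recursive oracle test is given by a function $g^Z$ computed by such a machine and a primitive recursive $f$ such that, for every real $Z$ and every $n$, $g^Z(n)$ codes a finite set $G^Z_n\subseteq\{0,1\}^{f(n)}$ with $\mu([G^Z_n])<2^{ -n}$. $X$ is $\mathrm{BP}$ random relative to $Y$ if for every primitive recursive oracle test there is $n$ with $X\notin[G^Y_n]$. -}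

module Defs where

open import Data.Bool using (Bool; true; false; if_then_else_; _∧_; _∨_; T)
open import Data.Nat using (ℕ; zero; suc; _+_; _*_; _^_; _≤_; _<_; _≡ᵇ_; _⊔_)
open import Data.Nat.DivMod using (_/_; _%_)
open import Data.List using (List; []; _∷_; length; take; map; filter; foldr; concatMap)
open import Data.List.Relation.Unary.All using (All)
open import Data.List.Relation.Unary.Any using (Any)
open import Data.Vec using (Vec; []; _∷_; lookup)
open import Data.Fin using (Fin)
open import Data.Product using (∃; _×_)
open import Relation.Binary.PropositionalEquality using (_≡_)
open import Relation.Nullary using (¬_)

-- Reals / subsets of ℕ are characteristic sequences ℕ → Bool.

Real : Set
Real = ℕ → Bool

-- A ⊕ B = {2x : x ∈ A} ∪ {2x+1 : x ∈ B}
_⊕_ : Real → Real → Real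
(A ⊕ B) zero = A zero
(A ⊕ B) (suc zero) = B zero
(A ⊕ B) (suc (suc n)) = ((λ k → A (suc k)) ⊕ (λ k → B (suc k))) n

_↾_ : Real → ℕ → List Bool
X ↾ zero = []
X ↾ suc n = X zero ∷ ((λ k → X (suc k)) ↾ n)

_≼ᵇ_ : List Bool → List Bool → Bool
[] ≼ᵇ τ = true
(b ∷ σ) ≼ᵇ [] = false
(true ∷ σ) ≼ᵇ (true ∷ τ) = σ ≼ᵇ τ
(false ∷ σ) ≼ᵇ (false ∷ τ) = σ ≼ᵇ τ
(true ∷ σ) ≼ᵇ (false ∷ τ) = false
(false ∷ σ) ≼ᵇ (true ∷ τ) = false

allStrings : ℕ → List (List Bool)
allStrings zero = [] ∷ []
allStrings (suc L) = concatMap (λ τ → (false ∷ τ) ∷ (true ∷ τ) ∷ []) (allStrings L)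

anyᵇ : {A : Set} → (A → Bool) → List A → Bool
anyᵇ p = foldr (λ a r → p a ∨ r) false

countᵇ : {A : Set} → (A → Bool) → List A → ℕ
countᵇ p = foldr (λ a r → if p a then suc r else r) 0

maxLen : List (List Bool) → ℕ
maxLen = foldr (λ σ r → length σ ⊔ r) 0

-- μ([G]) = muNum G / 2 ^ maxLen G  (number of strings of length maxLen G
-- extending some member of G, over 2^maxLen G)
muNum : List (List Bool) → ℕ
muNum G = countᵇ (λ τ → anyᵇ (λ σ → σ ≼ᵇ τ) G) (allStrings (maxLen G))

μ≤2^- : List (List Bool) → ℕ → Set
μ≤2^- G n = muNum G * 2 ^ n ≤ 2 ^ maxLen G

μ<2^- : List (List Bool) → ℕ → Set
μ<2^- G n = muNum G * 2 ^ n < 2 ^ maxLen G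

_∈[_] : Real → List (List Bool) → Set
X ∈[ G ] = Any (λ σ → σ ≡ X ↾ length σ) G

-- A string σ is coded by the number whose binary expansion
-- (least significant bit first) is σ followed by a 1; the finite set
-- coded by g is {strOf i : bit i of g is 1} (canonical index of finite sets).

toBits : ℕ → ℕ → List Bool
toBits zero n = []
toBits (suc f) zero = []
toBits (suc f) (suc n) = ((suc n % 2) ≡ᵇ 1) ∷ toBits f (suc n / 2)

dropLast : List Bool → List Bool
dropLast [] = []
dropLast (b ∷ []) = []
dropLast (b ∷ c ∷ σ) = b ∷ dropLast (c ∷ σ)

strOf : ℕ → List Bool
strOf n = dropLast (toBits n n)

testBit : ℕ → ℕ → Bool
testBit g zero = (g % 2) ≡ᵇ 1
testBit g (suc i) = testBit (g / 2) i

upTo : ℕ → List ℕ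
upTo zero = []
upTo (suc n) = n ∷ upTo n

decodeSet : ℕ → List (List Bool)
decodeSet g = map strOf (filter (λ i → T? (testBit g i)) (upTo g))
  where
  open import Relation.Nullary.Decidable using (Dec; yes; no)
  T? : (b : Bool) → Dec (T b)
  T? true = yes _
  T? false = no (λ ())

-- PrimRec true  n : functionals primitive recursive in an oracle Z
--   (the functions computed by oracle machines whose running time is
--    bounded by a primitive recursive function uniformly in Z).

data PrimRec : Bool → ℕ → Set where
  zer    : ∀ {O} → PrimRec O 0
  succ   : ∀ {O} → PrimRec O 1
  proj   : ∀ {O n} → Fin n → PrimRec O n
  comp   : ∀ {O m n} → PrimRec O m → Vec (PrimRec O n) m → PrimRec O n
  rec    : ∀ {O n} → PrimRec O n → PrimRec O (suc (suc n)) → PrimRec O (suc n)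
  oracle : PrimRec true 1

b2n : Bool → ℕ
b2n true = 1
b2n false = 0

mutual
  eval : ∀ {O n} → PrimRec O n → Real → Vec ℕ n → ℕ
  eval zer Z xs = 0
  eval succ Z (x ∷ []) = suc x
  eval (proj i) Z xs = lookup xs i
  eval (comp f gs) Z xs = eval f Z (evalAll gs Z xs)
  eval (rec f g) Z (zero ∷ xs) = eval f Z xs
  eval (rec f g) Z (suc y ∷ xs) = eval g Z (y ∷ eval (rec f g) Z (y ∷ xs) ∷ xs)
  eval oracle Z (x ∷ []) = b2n (Z x)

  evalAll : ∀ {O m n} → Vec (PrimRec O n) m → Real → Vec ℕ n → Vec ℕ m
  evalAll [] Z xs = []
  evalAll (g ∷ gs) Z xs = eval g Z xs ∷ evalAll gs Z xs

noOracle : Real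
noOracle _ = false

record PRTest : Set where
  field
    h     : PrimRec false 1
  G : ℕ → List (List Bool)
  G n = decodeSet (eval h noOracle (n ∷ []))
  field
    small : ∀ n → μ≤2^- (G n) n

BPRandom : Real → Set
BPRandom X = (T : PRTest) → ∃ λ n → ¬ (X ∈[ PRTest.G T n ])

record PROracleTest : Set where
  field
    g : PrimRec true 1
    f : PrimRec false 1
  G : Real → ℕ → List (List Bool)
  G Z n = decodeSet (eval g Z (n ∷ []))
  field
    lengths : ∀ Z n → All (λ σ → length σ ≡ eval f noOracle (n ∷ [])) (G Z n)
    small   : ∀ Z n → μ<2^- (G Z n) n

BPRandomRel : Real → Real → Set
BPRandomRel X Y = (T : PROracleTest) → ∃ λ n → ¬ (X ∈[ PROracleTest.G T Y n ])

{-# OPTIONS --safe #-}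
-- Let (G^Z_n) be a primitive recursive oracle test whose strings have length f(n), and let
-- m(n) be a primitive recursive majorant of the oracle queries made in computing G^Z_n.
-- With K = f(n) + m(n), let V_n be the set of strings τ of length 2K whose even half, cut
-- to length f(n), lies in G^Z_n for Z the odd half of τ. Since the oracle queries can be
-- answered from τ itself, the canonical index of V_n is primitive recursive in n; and
-- A ∈ [G^B_n] implies A ⊕ B ∈ [V_n]. Counting τ by first fixing its odd half (Fubini),
-- μ(V_n) is the average over Z of μ([G^Z_n]) < 2^-n, so (V_n) is a primitive recursive
-- test. A BP random A ⊕ B escapes some V_n and hence A escapes G^B_n; exchanging the two
-- halves gives the statement for B relative to A.
module Submission where

open import Defs
open import Data.Bool using (Bool; true; false; not; T)
open import Data.Empty using (⊥-elim)
open import Data.Fin using (zero; suc; inject₁; fromℕ)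
open import Data.List using (List; []; _∷_; [_]; length; _++_; concatMap)
open import Data.List.Membership.Propositional using (_∈_; find; lose)
open import Data.List.Membership.Propositional.Properties using (∈-map⁺; ∈-map⁻; ∈-filter⁺; ∈-filter⁻)
open import Data.List.Relation.Unary.All as ListAll using (All; []; _∷_)
open import Data.List.Relation.Unary.Any using (here; there)
open import Data.Nat
open import Data.Nat.DivMod
open import Data.Nat.Properties
open import Algebra.Properties.CommutativeSemigroup +-commutativeSemigroup using (interchange)
open import Data.Nat.Tactic.RingSolver using (solve-∀)
open import Data.Product using (∃; _×_; _,_; proj₁; proj₂)
open import Data.Sum using (_⊎_; inj₁; inj₂)
open import Data.Unit using (tt)
open import Data.Vec using (Vec; []; _∷_; _∷ʳ_; lookup)
import Data.Vec.Relation.Unary.All as VecAll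
import Data.Vec.Relation.Unary.All.Properties as VecAll
open import Function using (_∘_)
open import Relation.Binary.PropositionalEquality hiding ([_])
open import Relation.Nullary using (¬_; yes; no; contradiction)

infixr 5 _∷₂_

_∷₂_ : Bool → ℕ → ℕ
c ∷₂ m = b2n c + m * 2

b2n≤1 : ∀ c → b2n c ≤ 1
b2n≤1 true = ≤-refl
b2n≤1 false = z≤n

b2n-mono : ∀ {a b} → (a ≡ true → b ≡ true) → b2n a ≤ b2n b
b2n-mono {false} _ = z≤n
b2n-mono {true} a⇒b rewrite a⇒b refl = ≤-refl

∷₂-%2 : ∀ c m → (c ∷₂ m) % 2 ≡ b2n c
∷₂-%2 false m = m*n%n≡0 m 2
∷₂-%2 true m = [m+kn]%n≡m%n 1 m 2

∷₂-/2 : ∀ c m → (c ∷₂ m) / 2 ≡ m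
∷₂-/2 false m = m*n/n≡m m 2
∷₂-/2 true m = begin
  (1 + m * 2) / 2        ≡⟨ +-distrib-/ 1 (m * 2) (subst (λ r → 1 + r < 2) (sym (m*n%n≡0 m 2)) ≤-refl) ⟩
  1 / 2 + (m * 2) / 2    ≡⟨ cong (0 +_) (m*n/n≡m m 2) ⟩
  m                      ∎
  where open ≡-Reasoning

testBit-∷₂-zero : ∀ c m → testBit (c ∷₂ m) 0 ≡ c
testBit-∷₂-zero c m rewrite ∷₂-%2 c m with c
... | true = refl
... | false = refl

testBit-∷₂-suc : ∀ c m i → testBit (c ∷₂ m) (suc i) ≡ testBit m i
testBit-∷₂-suc c m i = cong (λ x → testBit x i) (∷₂-/2 c m)

testBit-zeroˡ : ∀ i → testBit 0 i ≡ false
testBit-zeroˡ zero = refl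
testBit-zeroˡ (suc i) = testBit-zeroˡ i

lsb∷₂half : ∀ x → x ≡ testBit x 0 ∷₂ (x / 2)
lsb∷₂half x = trans (m≡m%n+[m/n]*n x 2) (cong (_+ (x / 2) * 2) (remainder (x % 2) (m%n<n x 2)))
  where
  remainder : ∀ r → r < 2 → r ≡ b2n (r ≡ᵇ 1)
  remainder zero _ = refl
  remainder (suc zero) _ = refl
  remainder (suc (suc r)) (s≤s (s≤s ()))

testBit⇒2^≤ : ∀ g i → testBit g i ≡ true → 2 ^ i ≤ g
testBit⇒2^≤ zero i bit = contradiction (trans (sym (testBit-zeroˡ i)) bit) λ ()
testBit⇒2^≤ (suc g) zero _ = s≤s z≤n
testBit⇒2^≤ (suc g) (suc i) bit = begin
  2 ^ suc i         ≡⟨ *-comm 2 (2 ^ i) ⟩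
  2 ^ i * 2         ≤⟨ *-monoˡ-≤ 2 (testBit⇒2^≤ (suc g / 2) i bit) ⟩
  (suc g / 2) * 2   ≤⟨ m/n*n≤m (suc g) 2 ⟩
  suc g             ∎
  where open ≤-Reasoning

n<2^n : ∀ n → n < 2 ^ n
n<2^n zero = s≤s z≤n
n<2^n (suc n) = subst (_≤ 2 ^ suc n) (+-comm (suc n) 1) (+-mono-≤ (n<2^n n) (≤-trans (m^n>0 2 n) (m≤m+n (2 ^ n) 0)))

testBit⇒< : ∀ g i → testBit g i ≡ true → i < g
testBit⇒< g i bit = <-≤-trans (n<2^n i) (testBit⇒2^≤ g i bit)

2*m*n≡false∷₂m*n : ∀ m n → 2 * m * n ≡ false ∷₂ (m * n)
2*m*n≡false∷₂m*n m n = trans (*-assoc 2 m n) (*-comm 2 (m * n))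

testBit-2^*-< : ∀ N W i → i < N → testBit (2 ^ N * W) i ≡ false
testBit-2^*-< (suc N) W zero _ =
  trans (cong (λ x → testBit x 0) (2*m*n≡false∷₂m*n (2 ^ N) W)) (testBit-∷₂-zero false (2 ^ N * W))
testBit-2^*-< (suc N) W (suc i) (s≤s i<N) =
  trans (cong (λ x → testBit x (suc i)) (2*m*n≡false∷₂m*n (2 ^ N) W))
        (trans (testBit-∷₂-suc false (2 ^ N * W) i) (testBit-2^*-< N W i i<N))

testBit-2^*-+ : ∀ N W j → testBit (2 ^ N * W) (N + j) ≡ testBit W j
testBit-2^*-+ zero W j = cong (λ x → testBit x j) (*-identityˡ W)
testBit-2^*-+ (suc N) W j =
  trans (cong (λ x → testBit x (suc N + j)) (2*m*n≡false∷₂m*n (2 ^ N) W))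
        (trans (testBit-∷₂-suc false (2 ^ N * W) (N + j)) (testBit-2^*-+ N W j))

value : List Bool → ℕ
value [] = 0
value (b ∷ τ) = b ∷₂ value τ

bitAt : List Bool → Real
bitAt [] _ = false
bitAt (b ∷ τ) zero = b
bitAt (b ∷ τ) (suc j) = bitAt τ j

testBit-value : ∀ τ j → testBit (value τ) j ≡ bitAt τ j
testBit-value [] j = testBit-zeroˡ j
testBit-value (b ∷ τ) zero = testBit-∷₂-zero b (value τ)
testBit-value (b ∷ τ) (suc j) = trans (testBit-∷₂-suc b (value τ) j) (testBit-value τ j)

value<2^length : ∀ τ → value τ < 2 ^ length τ
value<2^length [] = s≤s z≤n
value<2^length (b ∷ τ) = begin-strict
  b2n b + value τ * 2          ≤⟨ +-monoˡ-≤ (value τ * 2) (b2n≤1 b) ⟩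
  1 + value τ * 2              <⟨ *-monoˡ-≤ 2 (value<2^length τ) ⟩
  2 ^ length τ * 2             ≡⟨ *-comm (2 ^ length τ) 2 ⟩
  2 ^ length (b ∷ τ)           ∎
  where open ≤-Reasoning

length-↾ : ∀ X L → length (X ↾ L) ≡ L
length-↾ X zero = refl
length-↾ X (suc L) = cong suc (length-↾ (X ∘ suc) L)

bitAt-↾ : ∀ X L j → j < L → bitAt (X ↾ L) j ≡ X j
bitAt-↾ X (suc L) zero _ = refl
bitAt-↾ X (suc L) (suc j) (s≤s j<L) = bitAt-↾ (X ∘ suc) L j j<L

bitAt-↾-true : ∀ X L j → bitAt (X ↾ L) j ≡ true → j < L × X j ≡ true
bitAt-↾-true X (suc L) zero bit = s≤s z≤n , bit
bitAt-↾-true X (suc L) (suc j) bit with bitAt-↾-true (X ∘ suc) L j bit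
... | j<L , Xj = s≤s j<L , Xj

↾-local : ∀ X Y L → (∀ j → j < L → X j ≡ Y j) → X ↾ L ≡ Y ↾ L
↾-local X Y zero _ = refl
↾-local X Y (suc L) agree =
  cong₂ _∷_ (agree 0 (s≤s z≤n)) (↾-local (X ∘ suc) (Y ∘ suc) L (λ j j<L → agree (suc j) (s≤s j<L)))

bitAt-++-↾ : ∀ σ ρ → bitAt (σ ++ ρ) ↾ length σ ≡ σ
bitAt-++-↾ [] ρ = refl
bitAt-++-↾ (b ∷ σ) ρ = cong (b ∷_) (bitAt-++-↾ σ ρ)

value-↾-testBit : ∀ L c → c < 2 ^ L → value (testBit c ↾ L) ≡ c
value-↾-testBit zero c c<1 = sym (n<1⇒n≡0 c<1)
value-↾-testBit (suc L) c c<2^L+1 =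
  trans (cong (testBit c 0 ∷₂_) (value-↾-testBit L (c / 2) half<)) (sym (lsb∷₂half c))
  where
  half< : c / 2 < 2 ^ L
  half< = *-cancelʳ-< _ _ _ (≤-<-trans (m/n*n≤m c 2) (<-≤-trans c<2^L+1 (≤-reflexive (*-comm 2 (2 ^ L)))))

value-↾-suc : ∀ X M → value (X ↾ suc M) ≡ value (X ↾ M) + b2n (X M) * 2 ^ M
value-↾-suc X zero = trans (+-identityʳ (b2n (X 0))) (sym (*-identityʳ (b2n (X 0))))
value-↾-suc X (suc M) = trans (cong (X 0 ∷₂_) (value-↾-suc (X ∘ suc) M))
                             (regroup (b2n (X 0)) (value ((X ∘ suc) ↾ M)) (b2n (X (suc M))) (2 ^ M))
  where
  regroup : ∀ a v b P → a + (v + b * P) * 2 ≡ (a + v * 2) + b * (2 * P)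
  regroup = solve-∀

-- Codes of strings and canonical indices

code : List Bool → ℕ
code σ = 2 ^ length σ + value σ

code-↾ : ∀ X L → code (X ↾ L) ≡ 2 ^ L + value (X ↾ L)
code-↾ X L = cong (λ l → 2 ^ l + value (X ↾ L)) (length-↾ X L)

code-∷ : ∀ b σ → code (b ∷ σ) ≡ b ∷₂ code σ
code-∷ b σ = regroup (b2n b) (2 ^ length σ) (value σ)
  where
  regroup : ∀ a P v → 2 * P + (a + v * 2) ≡ a + (P + v) * 2
  regroup = solve-∀

code-positive : ∀ σ → 0 < code σ
code-positive σ = ≤-trans (m^n>0 2 (length σ)) (m≤m+n _ _)

m<b∷₂m : ∀ b m → 0 < m → m < b ∷₂ m
m<b∷₂m b m 0<m = begin-strict
  m          <⟨ m<m+n m 0<m ⟩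
  m + m      ≡⟨ cong (m +_) (sym (+-identityʳ m)) ⟩
  2 * m      ≡⟨ *-comm 2 m ⟩
  m * 2      ≤⟨ m≤n+m (m * 2) (b2n b) ⟩
  b ∷₂ m     ∎
  where open ≤-Reasoning

dropLast-++ : ∀ σ b → dropLast (σ ++ [ b ]) ≡ σ
dropLast-++ [] b = refl
dropLast-++ (c ∷ []) b = refl
dropLast-++ (c ∷ d ∷ σ) b = cong (c ∷_) (dropLast-++ (d ∷ σ) b)

toBits-suc : ∀ fuel x → 0 < x → toBits (suc fuel) x ≡ testBit x 0 ∷ toBits fuel (x / 2)
toBits-suc fuel (suc x) _ = refl

toBits-zeroʳ : ∀ fuel → toBits fuel 0 ≡ []
toBits-zeroʳ zero = refl
toBits-zeroʳ (suc fuel) = refl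

toBits-code : ∀ σ fuel → code σ ≤ fuel → toBits fuel (code σ) ≡ σ ++ [ true ]
toBits-code σ zero le = contradiction (≤-trans (code-positive σ) le) λ ()
toBits-code [] (suc fuel) _ = cong (true ∷_) (toBits-zeroʳ fuel)
toBits-code (b ∷ σ) (suc fuel) le rewrite code-∷ b σ =
  trans (toBits-suc fuel _ (<-≤-trans (code-positive σ) (<⇒≤ σ<)))
        (cong₂ _∷_ (testBit-∷₂-zero b (code σ))
                   (trans (cong (toBits fuel) (∷₂-/2 b (code σ))) (toBits-code σ fuel (≤-pred (≤-trans σ< le)))))
  where
  σ< : code σ < b ∷₂ code σ
  σ< = m<b∷₂m b (code σ) (code-positive σ)

strOf-code : ∀ σ → strOf (code σ) ≡ σ
strOf-code σ = trans (cong dropLast (toBits-code σ (code σ) ≤-refl)) (dropLast-++ σ true)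

toBits-shape : ∀ fuel x → 0 < x → x ≤ fuel → ∃ λ s → toBits fuel x ≡ s ++ [ true ] × code s ≡ x
toBits-shape zero x 0<x le = contradiction (≤-trans 0<x le) λ ()
toBits-shape (suc fuel) x 0<x le = shape (testBit x 0) (x / 2) refl refl
  where
  shape : ∀ b h → testBit x 0 ≡ b → x / 2 ≡ h → ∃ λ s → toBits (suc fuel) x ≡ s ++ [ true ] × code s ≡ x
  shape b h lsb half with trans (lsb∷₂half x) (cong₂ _∷₂_ lsb half) | toBits-suc fuel x 0<x
  ... | x≡ | bits with b | h
  ... | false | zero = contradiction (subst (0 <_) x≡ 0<x) λ ()
  ... | true | zero = [] , trans bits (cong₂ _∷_ lsb (trans (cong (toBits fuel) half) (toBits-zeroʳ fuel))) , sym x≡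
  ... | c | suc h′
        with toBits-shape fuel (suc h′) (s≤s z≤n)
               (≤-pred (≤-trans (subst (suc h′ <_) (sym x≡) (m<b∷₂m c (suc h′) (s≤s z≤n))) le))
  ... | s , bits′ , codes = c ∷ s , trans bits (cong₂ _∷_ lsb (trans (cong (toBits fuel) half) bits′))
                                  , trans (code-∷ c s) (trans (cong (c ∷₂_) codes) (sym x≡))

code-strOf : ∀ i → 0 < i → code (strOf i) ≡ i
code-strOf i 0<i with toBits-shape i i 0<i ≤-refl
... | s , bits , codes = trans (cong (code ∘ dropLast) bits) (trans (cong code (dropLast-++ s true)) codes)

∈-upTo : ∀ {g i} → i < g → i ∈ upTo g
∈-upTo {suc g} {i} (s≤s i≤g) with m≤n⇒m<n∨m≡n i≤g
... | inj₁ i<g = there (∈-upTo i<g)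
... | inj₂ refl = here refl

∈-decodeSet⁺ : ∀ g i → testBit g i ≡ true → strOf i ∈ decodeSet g
∈-decodeSet⁺ g i bit = ∈-map⁺ strOf (∈-filter⁺ _ (∈-upTo (testBit⇒< g i bit)) (subst T (sym bit) tt))

∈-decodeSet⁻ : ∀ g σ → σ ∈ decodeSet g → ∃ λ i → testBit g i ≡ true × σ ≡ strOf i
∈-decodeSet⁻ g σ σ∈ with ∈-map⁻ strOf σ∈
... | i , i∈ , σ≡ = i , T⇒≡ (proj₂ (∈-filter⁻ {P = T ∘ testBit g} _ {xs = upTo g} i∈)) , σ≡
  where
  T⇒≡ : ∀ {b} → T b → b ≡ true
  T⇒≡ {true} _ = refl

code-∈-decodeSet : ∀ g σ → testBit g (code σ) ≡ true → σ ∈ decodeSet g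
code-∈-decodeSet g σ bit = subst (_∈ decodeSet g) (strOf-code σ) (∈-decodeSet⁺ g (code σ) bit)

-- Bit 0 of an index contributes the empty string, whose code is 1, not 0.
∈-decodeSet⇒testBit-code : ∀ g σ → σ ∈ decodeSet g → σ ≡ [] ⊎ testBit g (code σ) ≡ true
∈-decodeSet⇒testBit-code g σ σ∈ with ∈-decodeSet⁻ g σ σ∈
... | zero , _ , σ≡ = inj₁ σ≡
... | suc i , bit , σ≡ =
  inj₂ (subst (λ j → testBit g j ≡ true) (sym (trans (cong code σ≡) (code-strOf (suc i) (s≤s z≤n)))) bit)

-- Bit 2 ^ L + c is the code of the string of length L with value c.
canonicalIndex : ℕ → (ℕ → Bool) → ℕ
canonicalIndex L P = 2 ^ 2 ^ L * value (P ↾ (2 ^ L))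

∈-canonicalIndex⁺ : ∀ L P τ → length τ ≡ L → P (value τ) ≡ true → τ ∈ decodeSet (canonicalIndex L P)
∈-canonicalIndex⁺ L P τ refl Pτ = code-∈-decodeSet _ τ (begin
  testBit (canonicalIndex L P) (2 ^ L + value τ)   ≡⟨ testBit-2^*-+ (2 ^ L) _ (value τ) ⟩
  testBit (value (P ↾ (2 ^ L))) (value τ)          ≡⟨ testBit-value (P ↾ (2 ^ L)) (value τ) ⟩
  bitAt (P ↾ (2 ^ L)) (value τ)                    ≡⟨ bitAt-↾ P (2 ^ L) (value τ) (value<2^length τ) ⟩
  P (value τ)                                      ≡⟨ Pτ ⟩
  true                                             ∎)
  where open ≡-Reasoning

∈-canonicalIndex⁻ : ∀ L P σ → σ ∈ decodeSet (canonicalIndex L P) → length σ ≡ L × P (value σ) ≡ true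
∈-canonicalIndex⁻ L P σ σ∈ with ∈-decodeSet⁻ _ σ σ∈
... | i , bit , σ≡ with i <? 2 ^ L
... | yes i<N = contradiction (trans (sym bit) (testBit-2^*-< (2 ^ L) _ i i<N)) λ ()
... | no i≮N with m≤n⇒∃[o]m+o≡n (≮⇒≥ i≮N)
... | j , refl
    with bitAt-↾-true P (2 ^ L) j (trans (sym (testBit-value (P ↾ (2 ^ L)) j))
                                         (trans (sym (testBit-2^*-+ (2 ^ L) _ j)) bit))
... | j<N , Pj = trans (cong length σ≡′) (length-↾ (testBit j) L) , subst (λ v → P v ≡ true) (sym value≡) Pj
  where
  code≡ : code (testBit j ↾ L) ≡ 2 ^ L + j
  code≡ = trans (code-↾ (testBit j) L) (cong (2 ^ L +_) (value-↾-testBit L j j<N))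
  σ≡′ : σ ≡ testBit j ↾ L
  σ≡′ = trans σ≡ (trans (cong strOf (sym code≡)) (strOf-code (testBit j ↾ L)))
  value≡ : value σ ≡ j
  value≡ = trans (cong value σ≡′) (value-↾-testBit L j j<N)

-- Counting strings and measure

2*m*n≡m*n+m*n : ∀ m n → 2 * m * n ≡ m * n + m * n
2*m*n≡m*n+m*n = solve-∀

sumStrings : ℕ → (List Bool → ℕ) → ℕ
sumStrings zero q = q []
sumStrings (suc L) q = sumStrings L (q ∘ (false ∷_)) + sumStrings L (q ∘ (true ∷_))

sumStrings-cong : ∀ L {q r} → (∀ τ → length τ ≡ L → q τ ≡ r τ) → sumStrings L q ≡ sumStrings L r
sumStrings-cong zero q≡r = q≡r [] refl
sumStrings-cong (suc L) q≡r = cong₂ _+_ (sumStrings-cong L (λ τ l → q≡r (false ∷ τ) (cong suc l)))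
                                        (sumStrings-cong L (λ τ l → q≡r (true ∷ τ) (cong suc l)))

sumStrings-mono : ∀ L {q r} → (∀ τ → length τ ≡ L → q τ ≤ r τ) → sumStrings L q ≤ sumStrings L r
sumStrings-mono zero q≤r = q≤r [] refl
sumStrings-mono (suc L) q≤r = +-mono-≤ (sumStrings-mono L (λ τ l → q≤r (false ∷ τ) (cong suc l)))
                                       (sumStrings-mono L (λ τ l → q≤r (true ∷ τ) (cong suc l)))

sumStrings-+ : ∀ L q r → sumStrings L (λ τ → q τ + r τ) ≡ sumStrings L q + sumStrings L r
sumStrings-+ zero q r = refl
sumStrings-+ (suc L) q r =
  trans (cong₂ _+_ (sumStrings-+ L (q ∘ (false ∷_)) (r ∘ (false ∷_))) (sumStrings-+ L (q ∘ (true ∷_)) (r ∘ (true ∷_))))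
        (interchange (sumStrings L (q ∘ (false ∷_))) _ _ _)

sumStrings-const : ∀ L c → sumStrings L (λ _ → c) ≡ 2 ^ L * c
sumStrings-const zero c = sym (+-identityʳ c)
sumStrings-const (suc L) c = begin
  sumStrings L (λ _ → c) + sumStrings L (λ _ → c) ≡⟨ cong₂ _+_ (sumStrings-const L c) (sumStrings-const L c) ⟩
  2 ^ L * c + 2 ^ L * c                            ≡⟨ sym (2*m*n≡m*n+m*n (2 ^ L) c) ⟩
  2 ^ suc L * c                                    ∎
  where open ≡-Reasoning

sumStrings-comm : ∀ L M (F : List Bool → List Bool → ℕ) →
                  sumStrings L (λ α → sumStrings M (F α)) ≡ sumStrings M (λ β → sumStrings L (λ α → F α β))
sumStrings-comm zero M F = refl
sumStrings-comm (suc L) M F =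
  trans (cong₂ _+_ (sumStrings-comm L M (F ∘ (false ∷_))) (sumStrings-comm L M (F ∘ (true ∷_))))
        (sym (sumStrings-+ M _ _))

sumStrings-++ : ∀ M d q r → (∀ σ ρ → length σ ≡ M → q (σ ++ ρ) ≡ r σ) → sumStrings (M + d) q ≡ 2 ^ d * sumStrings M r
sumStrings-++ zero d q r q≡r = trans (sumStrings-cong d (λ ρ _ → q≡r [] ρ refl)) (sumStrings-const d (r []))
sumStrings-++ (suc M) d q r q≡r =
  trans (cong₂ _+_ (sumStrings-++ M d (q ∘ (false ∷_)) (r ∘ (false ∷_)) (λ σ ρ l → q≡r (false ∷ σ) ρ (cong suc l)))
                   (sumStrings-++ M d (q ∘ (true ∷_)) (r ∘ (true ∷_)) (λ σ ρ l → q≡r (true ∷ σ) ρ (cong suc l))))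
        (sym (*-distribˡ-+ (2 ^ d) _ _))

sumStrings-*-≤ : ∀ K q c B → (∀ τ → length τ ≡ K → q τ * c ≤ B) → sumStrings K q * c ≤ 2 ^ K * B
sumStrings-*-≤ zero q c B bound = ≤-trans (bound [] refl) (≤-reflexive (sym (+-identityʳ B)))
sumStrings-*-≤ (suc K) q c B bound = begin
  (sumStrings K q₀ + sumStrings K q₁) * c
    ≡⟨ *-distribʳ-+ c (sumStrings K q₀) (sumStrings K q₁) ⟩
  sumStrings K q₀ * c + sumStrings K q₁ * c
    ≤⟨ +-mono-≤ (sumStrings-*-≤ K q₀ c B (λ τ l → bound (false ∷ τ) (cong suc l)))
                (sumStrings-*-≤ K q₁ c B (λ τ l → bound (true ∷ τ) (cong suc l))) ⟩
  2 ^ K * B + 2 ^ K * B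
    ≡⟨ sym (2*m*n≡m*n+m*n (2 ^ K) B) ⟩
  2 ^ suc K * B
    ∎
  where
  open ≤-Reasoning
  q₀ q₁ : List Bool → ℕ
  q₀ = q ∘ (false ∷_)
  q₁ = q ∘ (true ∷_)

countᵇ-∷ : ∀ {A : Set} (P : A → Bool) x xs → countᵇ P (x ∷ xs) ≡ b2n (P x) + countᵇ P xs
countᵇ-∷ P x xs with P x
... | true = refl
... | false = refl

countᵇ-allStrings : ∀ L (P : List Bool → Bool) → countᵇ P (allStrings L) ≡ sumStrings L (b2n ∘ P)
countᵇ-allStrings zero P = trans (countᵇ-∷ P [] []) (+-identityʳ _)
countᵇ-allStrings (suc L) P =
  trans (countᵇ-concatMap (allStrings L)) (cong₂ _+_ (countᵇ-allStrings L _) (countᵇ-allStrings L _))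
  where
  P₀ P₁ : List Bool → Bool
  P₀ = P ∘ (false ∷_)
  P₁ = P ∘ (true ∷_)
  countᵇ-concatMap : ∀ xs → countᵇ P (concatMap (λ τ → (false ∷ τ) ∷ (true ∷ τ) ∷ []) xs)
                            ≡ countᵇ P₀ xs + countᵇ P₁ xs
  countᵇ-concatMap [] = refl
  countᵇ-concatMap (τ ∷ xs) = begin
    countᵇ P ((false ∷ τ) ∷ (true ∷ τ) ∷ rest)            ≡⟨ countᵇ-∷ P (false ∷ τ) ((true ∷ τ) ∷ rest) ⟩
    b2n (P₀ τ) + countᵇ P ((true ∷ τ) ∷ rest)             ≡⟨ cong (b2n (P₀ τ) +_) (countᵇ-∷ P (true ∷ τ) rest) ⟩
    b2n (P₀ τ) + (b2n (P₁ τ) + countᵇ P rest)             ≡⟨ cong (λ r → b2n (P₀ τ) + (b2n (P₁ τ) + r)) (countᵇ-concatMap xs) ⟩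
    b2n (P₀ τ) + (b2n (P₁ τ) + (countᵇ P₀ xs + countᵇ P₁ xs))
      ≡⟨ sym (+-assoc (b2n (P₀ τ)) _ _) ⟩
    (b2n (P₀ τ) + b2n (P₁ τ)) + (countᵇ P₀ xs + countᵇ P₁ xs)
      ≡⟨ interchange (b2n (P₀ τ)) _ _ _ ⟩
    (b2n (P₀ τ) + countᵇ P₀ xs) + (b2n (P₁ τ) + countᵇ P₁ xs)
      ≡⟨ sym (cong₂ _+_ (countᵇ-∷ P₀ τ xs) (countᵇ-∷ P₁ τ xs)) ⟩
    countᵇ P₀ (τ ∷ xs) + countᵇ P₁ (τ ∷ xs)                ∎
    where
    open ≡-Reasoning
    rest = concatMap (λ τ → (false ∷ τ) ∷ (true ∷ τ) ∷ []) xs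

covers : List (List Bool) → List Bool → Bool
covers G τ = anyᵇ (λ σ → σ ≼ᵇ τ) G

anyᵇ⁺ : ∀ {A : Set} (P : A → Bool) {xs x} → x ∈ xs → P x ≡ true → anyᵇ P xs ≡ true
anyᵇ⁺ P (here refl) Px rewrite Px = refl
anyᵇ⁺ P {y ∷ _} (there x∈) Px with P y
... | true = refl
... | false = anyᵇ⁺ P x∈ Px

anyᵇ⁻ : ∀ {A : Set} (P : A → Bool) xs → anyᵇ P xs ≡ true → ∃ λ x → x ∈ xs × P x ≡ true
anyᵇ⁻ P (y ∷ xs) any with P y in Py
... | true = y , here refl , Py
... | false with anyᵇ⁻ P xs any
... | x , x∈ , Px = x , there x∈ , Px

≼ᵇ-refl : ∀ σ → σ ≼ᵇ σ ≡ true
≼ᵇ-refl [] = refl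
≼ᵇ-refl (true ∷ σ) = ≼ᵇ-refl σ
≼ᵇ-refl (false ∷ σ) = ≼ᵇ-refl σ

≼ᵇ-length⇒≡ : ∀ σ τ → σ ≼ᵇ τ ≡ true → length σ ≡ length τ → σ ≡ τ
≼ᵇ-length⇒≡ [] [] _ _ = refl
≼ᵇ-length⇒≡ (true ∷ σ) (true ∷ τ) σ≼τ l = cong (true ∷_) (≼ᵇ-length⇒≡ σ τ σ≼τ (suc-injective l))
≼ᵇ-length⇒≡ (false ∷ σ) (false ∷ τ) σ≼τ l = cong (false ∷_) (≼ᵇ-length⇒≡ σ τ σ≼τ (suc-injective l))

∈⇒covers : ∀ {G σ} → σ ∈ G → covers G σ ≡ true
∈⇒covers {σ = σ} σ∈ = anyᵇ⁺ (_≼ᵇ σ) σ∈ (≼ᵇ-refl σ)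

covers⇒∈ : ∀ {L G τ} → All (λ σ → length σ ≡ L) G → length τ ≡ L → covers G τ ≡ true → τ ∈ G
covers⇒∈ {G = G} {τ} lengths l cov with anyᵇ⁻ (_≼ᵇ τ) G cov
... | σ , σ∈ , σ≼τ = subst (_∈ G) (≼ᵇ-length⇒≡ σ τ σ≼τ (trans (ListAll.lookup lengths σ∈) (sym l))) σ∈

maxLen-uniform : ∀ {L} G → All (λ σ → length σ ≡ L) G → maxLen G ≡ L ⊎ G ≡ []
maxLen-uniform [] [] = inj₂ refl
maxLen-uniform {L} (σ ∷ G) (l ∷ lengths) with maxLen-uniform G lengths
... | inj₁ m = inj₁ (trans (cong₂ _⊔_ l m) (⊔-idem L))
... | inj₂ refl = inj₁ (trans (⊔-identityʳ (length σ)) l)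

μ<2^-⇒sum≤ : ∀ {L} G n → All (λ σ → length σ ≡ L) G → μ<2^- G n →
             sumStrings L (b2n ∘ covers G) * 2 ^ n ≤ 2 ^ L
μ<2^-⇒sum≤ {L} G n lengths small with maxLen-uniform G lengths
... | inj₁ refl = <⇒≤ (subst (λ m → m * 2 ^ n < 2 ^ maxLen G) (countᵇ-allStrings (maxLen G) (covers G)) small)
... | inj₂ refl = ≤-trans (≤-reflexive (cong (_* 2 ^ n) (trans (sumStrings-const L 0) (*-zeroʳ (2 ^ L))))) z≤n

sum≤⇒μ≤2^- : ∀ {L} G n → All (λ σ → length σ ≡ L) G →
             sumStrings L (b2n ∘ covers G) * 2 ^ n ≤ 2 ^ L → μ≤2^- G n
sum≤⇒μ≤2^- G n lengths bound with maxLen-uniform G lengths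
... | inj₁ refl = subst (λ m → m * 2 ^ n ≤ 2 ^ maxLen G) (sym (countᵇ-allStrings (maxLen G) (covers G))) bound
... | inj₂ refl = z≤n

-- The empty string covers everything, so a set containing it has measure 1.
μ<2^-⇒[]∉ : ∀ G n → μ<2^- G n → ¬ [] ∈ G
μ<2^-⇒[]∉ G n small []∈ = <-irrefl refl (≤-<-trans full small)
  where
  M = 2 ^ maxLen G
  muNum≡ : muNum G ≡ M * 1
  muNum≡ = trans (countᵇ-allStrings (maxLen G) (covers G))
                 (trans (sumStrings-cong (maxLen G) (λ τ _ → cong b2n (anyᵇ⁺ (_≼ᵇ τ) []∈ refl)))
                        (sumStrings-const (maxLen G) 1))
  full : M ≤ muNum G * 2 ^ n
  full = begin
    M                  ≡⟨ sym (*-identityʳ M) ⟩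
    M * 1              ≤⟨ m≤m*n (M * 1) (2 ^ n) ⦃ m^n≢0 2 n ⦄ ⟩
    M * 1 * 2 ^ n      ≡⟨ cong (_* 2 ^ n) (sym muNum≡) ⟩
    muNum G * 2 ^ n    ∎
    where open ≤-Reasoning

sum-testBit-code≤ : ∀ {ℓ} g n → All (λ σ → length σ ≡ ℓ) (decodeSet g) → μ<2^- (decodeSet g) n →
                    sumStrings ℓ (λ σ → b2n (testBit g (code σ))) * 2 ^ n ≤ 2 ^ ℓ
sum-testBit-code≤ {ℓ} g n lengths small = begin
  sumStrings ℓ (λ σ → b2n (testBit g (code σ))) * 2 ^ n
    ≤⟨ *-monoˡ-≤ (2 ^ n) (sumStrings-mono ℓ (λ σ _ → b2n-mono (∈⇒covers ∘ code-∈-decodeSet g σ))) ⟩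
  sumStrings ℓ (b2n ∘ covers (decodeSet g)) * 2 ^ n
    ≤⟨ μ<2^-⇒sum≤ (decodeSet g) n lengths small ⟩
  2 ^ ℓ
    ∎
  where open ≤-Reasoning

pick : {A : Set} → Bool → A → A → A
pick false a b = a
pick true a b = b

pick-map : ∀ {A B : Set} (f : A → B) b x y → f (pick b x y) ≡ pick b (f x) (f y)
pick-map f false x y = refl
pick-map f true x y = refl

slot : Bool → ℕ → ℕ
slot b zero = b2n b
slot b (suc i) = suc (suc (slot b i))

component : Bool → Real → Real
component b X i = X (slot b i)

⊕-component : ∀ A B b i → component b (A ⊕ B) i ≡ pick b A B i
⊕-component A B false zero = refl
⊕-component A B true zero = refl
⊕-component A B false (suc i) = ⊕-component (A ∘ suc) (B ∘ suc) false i
⊕-component A B true (suc i) = ⊕-component (A ∘ suc) (B ∘ suc) true i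

slot-< : ∀ b {i K} → i < K → slot b i < K + K
slot-< false {zero} {suc K} _ = s≤s z≤n
slot-< true {zero} {suc K} _ = s≤s (subst (0 <_) (sym (+-suc K K)) (s≤s z≤n))
slot-< b {suc i} {suc K} (s≤s i<K) = s≤s (subst (suc (slot b i) <_) (sym (+-suc K K)) (s≤s (slot-< b i<K)))

double : ℕ → ℕ
double zero = zero
double (suc K) = suc (suc (double K))

double≡+ : ∀ K → double K ≡ K + K
double≡+ zero = refl
double≡+ (suc K) = cong suc (trans (cong suc (double≡+ K)) (sym (+-suc K K)))

-- Going through ⊕ makes interleave (suc K) (a ∷ α) (b ∷ β) reduce to a ∷ b ∷ interleave K α β.
interleave : ℕ → List Bool → List Bool → List Bool
interleave K α β = (bitAt α ⊕ bitAt β) ↾ double K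

sumStrings-interleave : ∀ K q → sumStrings (double K) q ≡ sumStrings K (λ α → sumStrings K (λ β → q (interleave K α β)))
sumStrings-interleave zero q = refl
sumStrings-interleave (suc K) q = begin
  (S₂ q₀₀ + S₂ q₀₁) + (S₂ q₁₀ + S₂ q₁₁)
    ≡⟨ cong₂ _+_ (cong₂ _+_ (sumStrings-interleave K q₀₀) (sumStrings-interleave K q₀₁))
                 (cong₂ _+_ (sumStrings-interleave K q₁₀) (sumStrings-interleave K q₁₁)) ⟩
  (S (λ α → S (λ β → q₀₀ (ι α β))) + S (λ α → S (λ β → q₀₁ (ι α β))))
    + (S (λ α → S (λ β → q₁₀ (ι α β))) + S (λ α → S (λ β → q₁₁ (ι α β))))
    ≡⟨ sym (cong₂ _+_ (sumStrings-+ K _ _) (sumStrings-+ K _ _)) ⟩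
  S (λ α → S (λ β → q₀₀ (ι α β)) + S (λ β → q₀₁ (ι α β)))
    + S (λ α → S (λ β → q₁₀ (ι α β)) + S (λ β → q₁₁ (ι α β)))
    ∎
  where
  open ≡-Reasoning
  S S₂ : (List Bool → ℕ) → ℕ
  S = sumStrings K
  S₂ = sumStrings (double K)
  ι : List Bool → List Bool → List Bool
  ι = interleave K
  q₀₀ q₀₁ q₁₀ q₁₁ : List Bool → ℕ
  q₀₀ τ = q (false ∷ false ∷ τ)
  q₀₁ τ = q (false ∷ true ∷ τ)
  q₁₀ τ = q (true ∷ false ∷ τ)
  q₁₁ τ = q (true ∷ true ∷ τ)

sumStrings-pick : ∀ p K (H : List Bool → List Bool → ℕ) →
                  sumStrings K (λ α → sumStrings K (λ β → H (pick p α β) (pick (not p) α β)))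
                  ≡ sumStrings K (λ o → sumStrings K (λ t → H t o))
sumStrings-pick false K H = sumStrings-comm K K H
sumStrings-pick true K H = refl

constᴾ : ∀ {O} → ℕ → PrimRec O 0
constᴾ zero = zer
constᴾ (suc k) = comp succ (constᴾ k ∷ [])

zeroᴾ : ∀ {O n} → PrimRec O n
zeroᴾ = comp zer []

addᴾ : ∀ {O} → PrimRec O 2
addᴾ = rec (proj zero) (comp succ (proj (suc zero) ∷ []))

eval-addᴾ : ∀ {O} Z x y → eval (addᴾ {O}) Z (x ∷ y ∷ []) ≡ x + y
eval-addᴾ Z zero y = refl
eval-addᴾ Z (suc x) y = cong suc (eval-addᴾ Z x y)

mulᴾ : ∀ {O} → PrimRec O 2
mulᴾ = rec zeroᴾ (comp addᴾ (proj (suc zero) ∷ proj (suc (suc zero)) ∷ []))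

eval-mulᴾ : ∀ {O} Z x y → eval (mulᴾ {O}) Z (x ∷ y ∷ []) ≡ x * y
eval-mulᴾ Z zero y = refl
eval-mulᴾ {O} Z (suc x) y = begin
  eval addᴾ Z (eval mulᴾ Z (x ∷ y ∷ []) ∷ y ∷ [])   ≡⟨ eval-addᴾ Z _ y ⟩
  eval (mulᴾ {O}) Z (x ∷ y ∷ []) + y               ≡⟨ cong (_+ y) (eval-mulᴾ Z x y) ⟩
  x * y + y                                        ≡⟨ +-comm (x * y) y ⟩
  suc x * y                                        ∎
  where open ≡-Reasoning

pow2ᴾ : ∀ {O} → PrimRec O 1
pow2ᴾ = rec (constᴾ 1) (comp addᴾ (proj (suc zero) ∷ proj (suc zero) ∷ []))

eval-pow2ᴾ : ∀ {O} Z x → eval (pow2ᴾ {O}) Z (x ∷ []) ≡ 2 ^ x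
eval-pow2ᴾ Z zero = refl
eval-pow2ᴾ {O} Z (suc x) = begin
  eval addᴾ Z (r ∷ r ∷ [])   ≡⟨ eval-addᴾ Z r r ⟩
  r + r                      ≡⟨ cong (λ s → s + s) (eval-pow2ᴾ Z x) ⟩
  2 ^ x + 2 ^ x              ≡⟨ cong (2 ^ x +_) (sym (+-identityʳ (2 ^ x))) ⟩
  2 ^ suc x                  ∎
  where
  open ≡-Reasoning
  r = eval (pow2ᴾ {O}) Z (x ∷ [])

notᴾ : ∀ {O} → PrimRec O 1
notᴾ = rec (constᴾ 1) zeroᴾ

eval-notᴾ : ∀ {O} Z b → eval (notᴾ {O}) Z (b2n b ∷ []) ≡ b2n (not b)
eval-notᴾ Z true = refl
eval-notᴾ Z false = refl

suc-∷₂ : ∀ b h → suc (b ∷₂ h) ≡ not b ∷₂ (h + b2n b)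
suc-∷₂ false h = cong (λ m → suc (m * 2)) (sym (+-identityʳ h))
suc-∷₂ true h = cong (_* 2) (+-comm 1 h)

suc≡lsb∷₂half : ∀ x → suc x ≡ not (testBit x 0) ∷₂ (x / 2 + b2n (testBit x 0))
suc≡lsb∷₂half x = trans (cong suc (lsb∷₂half x)) (suc-∷₂ (testBit x 0) (x / 2))

testBit-suc-zero : ∀ x → testBit (suc x) 0 ≡ not (testBit x 0)
testBit-suc-zero x = trans (cong (λ y → testBit y 0) (suc≡lsb∷₂half x))
                           (testBit-∷₂-zero (not (testBit x 0)) (x / 2 + b2n (testBit x 0)))

suc-/2 : ∀ x → suc x / 2 ≡ x / 2 + b2n (testBit x 0)
suc-/2 x = trans (cong (_/ 2) (suc≡lsb∷₂half x)) (∷₂-/2 (not (testBit x 0)) (x / 2 + b2n (testBit x 0)))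

parityᴾ : ∀ {O} → PrimRec O 1
parityᴾ = rec zeroᴾ (comp notᴾ (proj (suc zero) ∷ []))

eval-parityᴾ : ∀ {O} Z x → eval (parityᴾ {O}) Z (x ∷ []) ≡ b2n (testBit x 0)
eval-parityᴾ Z zero = refl
eval-parityᴾ {O} Z (suc x) = begin
  eval notᴾ Z (eval parityᴾ Z (x ∷ []) ∷ [])   ≡⟨ cong (λ r → eval notᴾ Z (r ∷ [])) (eval-parityᴾ Z x) ⟩
  eval (notᴾ {O}) Z (b2n (testBit x 0) ∷ [])   ≡⟨ eval-notᴾ Z (testBit x 0) ⟩
  b2n (not (testBit x 0))                      ≡⟨ cong b2n (sym (testBit-suc-zero x)) ⟩
  b2n (testBit (suc x) 0)                      ∎
  where open ≡-Reasoning

halfᴾ : ∀ {O} → PrimRec O 1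
halfᴾ = rec zeroᴾ (comp addᴾ (proj (suc zero) ∷ comp parityᴾ (proj zero ∷ []) ∷ []))

eval-halfᴾ : ∀ {O} Z x → eval (halfᴾ {O}) Z (x ∷ []) ≡ x / 2
eval-halfᴾ Z zero = refl
eval-halfᴾ {O} Z (suc x) = begin
  eval addᴾ Z (eval halfᴾ Z (x ∷ []) ∷ eval parityᴾ Z (x ∷ []) ∷ [])
    ≡⟨ eval-addᴾ {O} Z (eval (halfᴾ {O}) Z (x ∷ [])) (eval (parityᴾ {O}) Z (x ∷ [])) ⟩
  eval (halfᴾ {O}) Z (x ∷ []) + eval (parityᴾ {O}) Z (x ∷ [])
    ≡⟨ cong₂ _+_ (eval-halfᴾ Z x) (eval-parityᴾ Z x) ⟩
  x / 2 + b2n (testBit x 0)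
    ≡⟨ sym (suc-/2 x) ⟩
  suc x / 2
    ∎
  where open ≡-Reasoning

halvings : ℕ → ℕ → ℕ
halvings zero c = c
halvings (suc i) c = halvings i c / 2

halvings-/2 : ∀ i c → halvings i (c / 2) ≡ halvings i c / 2
halvings-/2 zero c = refl
halvings-/2 (suc i) c = cong (_/ 2) (halvings-/2 i c)

testBit-halvings : ∀ i c → testBit c i ≡ testBit (halvings i c) 0
testBit-halvings zero c = refl
testBit-halvings (suc i) c = trans (testBit-halvings i (c / 2)) (cong (λ x → testBit x 0) (halvings-/2 i c))

halvingsᴾ : ∀ {O} → PrimRec O 2
halvingsᴾ = rec (proj zero) (comp halfᴾ (proj (suc zero) ∷ []))

eval-halvingsᴾ : ∀ {O} Z i c → eval (halvingsᴾ {O}) Z (i ∷ c ∷ []) ≡ halvings i c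
eval-halvingsᴾ Z zero c = refl
eval-halvingsᴾ {O} Z (suc i) c =
  trans (eval-halfᴾ Z (eval (halvingsᴾ {O}) Z (i ∷ c ∷ []))) (cong (_/ 2) (eval-halvingsᴾ Z i c))

testBitᴾ : ∀ {O} → PrimRec O 2
testBitᴾ = comp parityᴾ (halvingsᴾ ∷ [])

eval-testBitᴾ : ∀ {O} Z i c → eval (testBitᴾ {O}) Z (i ∷ c ∷ []) ≡ b2n (testBit c i)
eval-testBitᴾ {O} Z i c = begin
  eval parityᴾ Z (eval halvingsᴾ Z (i ∷ c ∷ []) ∷ [])  ≡⟨ cong (λ x → eval parityᴾ Z (x ∷ [])) (eval-halvingsᴾ Z i c) ⟩
  eval (parityᴾ {O}) Z (halvings i c ∷ [])           ≡⟨ eval-parityᴾ Z (halvings i c) ⟩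
  b2n (testBit (halvings i c) 0)                     ≡⟨ cong b2n (sym (testBit-halvings i c)) ⟩
  b2n (testBit c i)                                  ∎
  where open ≡-Reasoning

valueᴾ : ∀ {O} → PrimRec O 2 → PrimRec O 2
valueᴾ b = rec zeroᴾ (comp addᴾ (proj (suc zero)
                               ∷ comp mulᴾ (comp b (proj zero ∷ proj (suc (suc zero)) ∷ []) ∷ comp pow2ᴾ (proj zero ∷ []) ∷ [])
                               ∷ []))

eval-valueᴾ : ∀ {O} (b : PrimRec O 2) (P : ℕ → Real) Z → (∀ i x → eval b Z (i ∷ x ∷ []) ≡ b2n (P x i)) →
              ∀ M x → eval (valueᴾ b) Z (M ∷ x ∷ []) ≡ value (P x ↾ M)
eval-valueᴾ b P Z b≡ zero x = refl
eval-valueᴾ {O} b P Z b≡ (suc M) x = begin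
  eval addᴾ Z (v ∷ eval mulᴾ Z (eval b Z (M ∷ x ∷ []) ∷ eval pow2ᴾ Z (M ∷ []) ∷ []) ∷ [])
    ≡⟨ eval-addᴾ {O} Z v _ ⟩
  v + eval (mulᴾ {O}) Z (eval b Z (M ∷ x ∷ []) ∷ eval pow2ᴾ Z (M ∷ []) ∷ [])
    ≡⟨ cong (v +_) (eval-mulᴾ {O} Z (eval b Z (M ∷ x ∷ [])) (eval (pow2ᴾ {O}) Z (M ∷ []))) ⟩
  v + eval b Z (M ∷ x ∷ []) * eval (pow2ᴾ {O}) Z (M ∷ [])
    ≡⟨ cong₂ (λ r s → r + s * eval (pow2ᴾ {O}) Z (M ∷ [])) (eval-valueᴾ b P Z b≡ M x) (b≡ M x) ⟩
  value (P x ↾ M) + b2n (P x M) * eval (pow2ᴾ {O}) Z (M ∷ [])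
    ≡⟨ cong (λ r → value (P x ↾ M) + b2n (P x M) * r) (eval-pow2ᴾ Z M) ⟩
  value (P x ↾ M) + b2n (P x M) * 2 ^ M
    ≡⟨ sym (value-↾-suc (P x) M) ⟩
  value (P x ↾ suc M)
    ∎
  where
  open ≡-Reasoning
  v = eval (valueᴾ b) Z (M ∷ x ∷ [])

canonicalIndexᴾ : ∀ {O} → PrimRec O 1 → PrimRec O 2 → PrimRec O 1
canonicalIndexᴾ lengthᴾ predicateᴾ =
  comp mulᴾ (comp pow2ᴾ (sizeᴾ ∷ []) ∷ comp (valueᴾ predicateᴾ) (sizeᴾ ∷ proj zero ∷ []) ∷ [])
  where
  sizeᴾ = comp pow2ᴾ (lengthᴾ ∷ [])

eval-canonicalIndexᴾ : ∀ {O} (lengthᴾ : PrimRec O 1) (predicateᴾ : PrimRec O 2) Z (ℓ : ℕ → ℕ) (P : ℕ → ℕ → Bool) →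
                       (∀ n → eval lengthᴾ Z (n ∷ []) ≡ ℓ n) → (∀ c n → eval predicateᴾ Z (c ∷ n ∷ []) ≡ b2n (P n c)) →
                       ∀ n → eval (canonicalIndexᴾ lengthᴾ predicateᴾ) Z (n ∷ []) ≡ canonicalIndex (ℓ n) (P n)
eval-canonicalIndexᴾ {O} lengthᴾ predicateᴾ Z ℓ P length≡ predicate≡ n =
  trans (eval-mulᴾ Z (eval pow2ᴾ Z (size ∷ [])) (eval (valueᴾ predicateᴾ) Z (size ∷ n ∷ [])))
        (cong₂ _*_ (trans (eval-pow2ᴾ Z size) (cong (2 ^_) size≡))
                   (trans (eval-valueᴾ predicateᴾ P Z predicate≡ size n) (cong (λ N → value (P n ↾ N)) size≡)))
  where
  size = eval (pow2ᴾ {O}) Z (eval lengthᴾ Z (n ∷ []) ∷ [])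
  size≡ : size ≡ 2 ^ ℓ n
  size≡ = trans (eval-pow2ᴾ {O} Z (eval lengthᴾ Z (n ∷ []))) (cong (2 ^_) (length≡ n))

slotᴾ : ∀ {O} → Bool → PrimRec O 1
slotᴾ b = rec (constᴾ (b2n b)) (comp succ (comp succ (proj (suc zero) ∷ []) ∷ []))

eval-slotᴾ : ∀ {O} Z b i → eval (slotᴾ {O} b) Z (i ∷ []) ≡ slot b i
eval-slotᴾ Z false zero = refl
eval-slotᴾ Z true zero = refl
eval-slotᴾ {O} Z b (suc i) = cong (λ j → suc (suc j)) (eval-slotᴾ {O} Z b i)

componentBitᴾ : ∀ {O} → Bool → PrimRec O 2
componentBitᴾ b = comp testBitᴾ (comp (slotᴾ b) (proj zero ∷ []) ∷ proj (suc zero) ∷ [])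

eval-componentBitᴾ : ∀ {O} Z b i c → eval (componentBitᴾ {O} b) Z (i ∷ c ∷ []) ≡ b2n (component b (testBit c) i)
eval-componentBitᴾ {O} Z b i c =
  trans (eval-testBitᴾ {O} Z (eval (slotᴾ {O} b) Z (i ∷ [])) c) (cong (b2n ∘ testBit c) (eval-slotᴾ {O} Z b i))

-- Eliminating the oracle

lookup-∷ʳ-inject₁ : ∀ {n} (xs : Vec ℕ n) c i → lookup (xs ∷ʳ c) (inject₁ i) ≡ lookup xs i
lookup-∷ʳ-inject₁ (x ∷ xs) c zero = refl
lookup-∷ʳ-inject₁ (x ∷ xs) c (suc i) = lookup-∷ʳ-inject₁ xs c i

lookup-∷ʳ-last : ∀ {n} (xs : Vec ℕ n) c → lookup (xs ∷ʳ c) (fromℕ n) ≡ c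
lookup-∷ʳ-last [] c = refl
lookup-∷ʳ-last (x ∷ xs) c = lookup-∷ʳ-last xs c

evalAll-∷ʳ : ∀ {O m n} (ts : Vec (PrimRec O n) m) t Z xs → evalAll (ts ∷ʳ t) Z xs ≡ evalAll ts Z xs ∷ʳ eval t Z xs
evalAll-∷ʳ [] t Z xs = refl
evalAll-∷ʳ (s ∷ ts) t Z xs = cong (eval s Z xs ∷_) (evalAll-∷ʳ ts t Z xs)

mutual
  substOracle : ∀ {O n} → PrimRec false 2 → PrimRec O n → PrimRec false (suc n)
  substOracle r zer = zeroᴾ
  substOracle r succ = comp succ (proj zero ∷ [])
  substOracle r (proj i) = proj (inject₁ i)
  substOracle r (comp {n = n} f gs) = comp (substOracle r f) (substOracle* r gs ∷ʳ proj (fromℕ n))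
  substOracle r (rec f g) = rec (substOracle r f) (substOracle r g)
  substOracle r oracle = comp r (proj zero ∷ proj (suc zero) ∷ [])

  substOracle* : ∀ {O m n} → PrimRec false 2 → Vec (PrimRec O n) m → Vec (PrimRec false (suc n)) m
  substOracle* r [] = []
  substOracle* r (g ∷ gs) = substOracle r g ∷ substOracle* r gs

module _ (r : PrimRec false 2) (Y : ℕ → Real) (Z : Real)
         (eval-r : ∀ x c → eval r Z (x ∷ c ∷ []) ≡ b2n (Y c x)) where

  mutual
    eval-substOracle : ∀ {O n} (t : PrimRec O n) c xs → eval (substOracle r t) Z (xs ∷ʳ c) ≡ eval t (Y c) xs
    eval-substOracle zer c [] = refl
    eval-substOracle succ c (x ∷ []) = refl
    eval-substOracle (proj i) c xs = lookup-∷ʳ-inject₁ xs c i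
    eval-substOracle (comp {n = n} f gs) c xs = begin
      eval (substOracle r f) Z (evalAll (substOracle* r gs ∷ʳ proj (fromℕ n)) Z (xs ∷ʳ c))
        ≡⟨ cong (eval (substOracle r f) Z) (evalAll-∷ʳ (substOracle* r gs) (proj (fromℕ n)) Z (xs ∷ʳ c)) ⟩
      eval (substOracle r f) Z (evalAll (substOracle* r gs) Z (xs ∷ʳ c) ∷ʳ lookup (xs ∷ʳ c) (fromℕ n))
        ≡⟨ cong (eval (substOracle r f) Z) (cong₂ _∷ʳ_ (eval-substOracle* gs c xs) (lookup-∷ʳ-last xs c)) ⟩
      eval (substOracle r f) Z (evalAll gs (Y c) xs ∷ʳ c)
        ≡⟨ eval-substOracle f c (evalAll gs (Y c) xs) ⟩
      eval f (Y c) (evalAll gs (Y c) xs)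
        ∎
      where open ≡-Reasoning
    eval-substOracle (rec f g) c (zero ∷ xs) = eval-substOracle f c xs
    eval-substOracle (rec f g) c (suc y ∷ xs) =
      trans (eval-substOracle g c (y ∷ eval (substOracle r (rec f g)) Z (y ∷ (xs ∷ʳ c)) ∷ xs))
            (cong (λ v → eval g (Y c) (y ∷ v ∷ xs)) (eval-substOracle (rec f g) c (y ∷ xs)))
    eval-substOracle oracle c (x ∷ []) = eval-r x c

    eval-substOracle* : ∀ {O m n} (gs : Vec (PrimRec O n) m) c xs →
                        evalAll (substOracle* r gs) Z (xs ∷ʳ c) ≡ evalAll gs (Y c) xs
    eval-substOracle* [] c xs = refl
    eval-substOracle* (g ∷ gs) c xs = cong₂ _∷_ (eval-substOracle g c xs) (eval-substOracle* gs c xs)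

-- Majorants and the use principle

mutual
  majorant : ∀ {O n} → PrimRec O n → ℕ → ℕ
  majorant zer m = m
  majorant succ m = suc m
  majorant (proj i) m = m
  majorant oracle m = suc m
  majorant (comp f gs) m = majorant f (majorant* gs m) + majorant* gs m
  majorant (rec f g) m = majorantRec f g m m

  majorant* : ∀ {O k n} → Vec (PrimRec O n) k → ℕ → ℕ
  majorant* [] m = m
  majorant* (g ∷ gs) m = majorant g m + majorant* gs m

  majorantRec : ∀ {O n} → PrimRec O n → PrimRec O (suc (suc n)) → ℕ → ℕ → ℕ
  majorantRec f g m zero = majorant f m + m
  majorantRec f g m (suc k) = majorant g (majorantRec f g m k) + majorantRec f g m k

mutual
  majorantᴾ : ∀ {O n} → PrimRec O n → PrimRec false 1
  majorantᴾ zer = proj zero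
  majorantᴾ succ = succ
  majorantᴾ (proj i) = proj zero
  majorantᴾ oracle = succ
  majorantᴾ (comp f gs) = comp addᴾ (comp (majorantᴾ f) (majorant*ᴾ gs ∷ []) ∷ majorant*ᴾ gs ∷ [])
  majorantᴾ (rec f g) = comp (majorantRecᴾ f g) (proj zero ∷ proj zero ∷ [])

  majorant*ᴾ : ∀ {O k n} → Vec (PrimRec O n) k → PrimRec false 1
  majorant*ᴾ [] = proj zero
  majorant*ᴾ (g ∷ gs) = comp addᴾ (majorantᴾ g ∷ majorant*ᴾ gs ∷ [])

  majorantRecᴾ : ∀ {O n} → PrimRec O n → PrimRec O (suc (suc n)) → PrimRec false 2
  majorantRecᴾ f g = rec (comp addᴾ (majorantᴾ f ∷ proj zero ∷ []))
                         (comp addᴾ (comp (majorantᴾ g) (proj (suc zero) ∷ []) ∷ proj (suc zero) ∷ []))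

mutual
  eval-majorantᴾ : ∀ {O n} (t : PrimRec O n) Z m → eval (majorantᴾ t) Z (m ∷ []) ≡ majorant t m
  eval-majorantᴾ zer Z m = refl
  eval-majorantᴾ succ Z m = refl
  eval-majorantᴾ (proj i) Z m = refl
  eval-majorantᴾ oracle Z m = refl
  eval-majorantᴾ (comp f gs) Z m =
    trans (eval-addᴾ Z (eval (majorantᴾ f) Z (eval (majorant*ᴾ gs) Z (m ∷ []) ∷ [])) (eval (majorant*ᴾ gs) Z (m ∷ [])))
          (cong₂ _+_ (trans (cong (λ k → eval (majorantᴾ f) Z (k ∷ [])) (eval-majorant*ᴾ gs Z m))
                            (eval-majorantᴾ f Z (majorant* gs m)))
                     (eval-majorant*ᴾ gs Z m))
  eval-majorantᴾ (rec f g) Z m = eval-majorantRecᴾ f g Z m m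

  eval-majorant*ᴾ : ∀ {O k n} (gs : Vec (PrimRec O n) k) Z m → eval (majorant*ᴾ gs) Z (m ∷ []) ≡ majorant* gs m
  eval-majorant*ᴾ [] Z m = refl
  eval-majorant*ᴾ (g ∷ gs) Z m =
    trans (eval-addᴾ Z (eval (majorantᴾ g) Z (m ∷ [])) (eval (majorant*ᴾ gs) Z (m ∷ [])))
          (cong₂ _+_ (eval-majorantᴾ g Z m) (eval-majorant*ᴾ gs Z m))

  eval-majorantRecᴾ : ∀ {O n} (f : PrimRec O n) g Z m k → eval (majorantRecᴾ f g) Z (k ∷ m ∷ []) ≡ majorantRec f g m k
  eval-majorantRecᴾ f g Z m zero =
    trans (eval-addᴾ Z (eval (majorantᴾ f) Z (m ∷ [])) m) (cong (_+ m) (eval-majorantᴾ f Z m))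
  eval-majorantRecᴾ f g Z m (suc k) =
    trans (eval-addᴾ Z (eval (majorantᴾ g) Z (r ∷ [])) r)
          (trans (cong (λ s → eval (majorantᴾ g) Z (s ∷ []) + s) (eval-majorantRecᴾ f g Z m k))
                 (cong (_+ majorantRec f g m k) (eval-majorantᴾ g Z (majorantRec f g m k))))
    where
    r = eval (majorantRecᴾ f g) Z (k ∷ m ∷ [])

majorantRec-mono : ∀ {O n} (f : PrimRec O n) g m {k k′} → k ≤ k′ → majorantRec f g m k ≤ majorantRec f g m k′
majorantRec-mono f g m {k′ = zero} z≤n = ≤-refl
majorantRec-mono f g m {k} {suc k′} k≤k′ with m≤n⇒m<n∨m≡n k≤k′
... | inj₁ (s≤s k≤k′′) = ≤-trans (majorantRec-mono f g m k≤k′′) (m≤n+m _ _)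
... | inj₂ refl = ≤-refl

majorantRec-≥ : ∀ {O n} (f : PrimRec O n) g m k → m ≤ majorantRec f g m k
majorantRec-≥ f g m k = ≤-trans (m≤n+m m (majorant f m)) (majorantRec-mono f g m {k′ = k} z≤n)

Bounded : ∀ {n} → ℕ → Vec ℕ n → Set
Bounded m = VecAll.All (_≤ m)

Bounded-mono : ∀ {n m m′} {xs : Vec ℕ n} → m ≤ m′ → Bounded m xs → Bounded m′ xs
Bounded-mono m≤m′ = VecAll.map (λ x≤m → ≤-trans x≤m m≤m′)

mutual
  eval-local : ∀ {O n} (t : PrimRec O n) Z Z′ m xs → Bounded m xs → (∀ x → x < majorant t m → Z x ≡ Z′ x) →
               eval t Z xs ≡ eval t Z′ xs × eval t Z xs ≤ majorant t m
  eval-local zer Z Z′ m xs _ _ = refl , z≤n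
  eval-local succ Z Z′ m (x ∷ []) (x≤m VecAll.∷ _) _ = refl , s≤s x≤m
  eval-local (proj i) Z Z′ m xs bounded _ = refl , VecAll.lookup⁺ bounded i
  eval-local oracle Z Z′ m (x ∷ []) (x≤m VecAll.∷ _) agree = cong b2n (agree x (s≤s x≤m)) , ≤-trans (b2n≤1 (Z x)) (s≤s z≤n)
  eval-local (comp f gs) Z Z′ m xs bounded agree
    with eval-local* gs Z Z′ m xs bounded (λ x x< → agree x (≤-trans x< (m≤n+m _ _)))
  ... | gs≡ , gs≤ with eval-local f Z Z′ (majorant* gs m) (evalAll gs Z xs) gs≤ (λ x x< → agree x (≤-trans x< (m≤m+n _ _)))
  ... | f≡ , f≤ = trans f≡ (cong (eval f Z′) gs≡) , ≤-trans f≤ (m≤m+n _ _)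
  eval-local (rec f g) Z Z′ m (y ∷ xs) (y≤m VecAll.∷ bounded) agree
    with eval-localRec f g Z Z′ m xs bounded agree y y≤m
  ... | rec≡ , rec≤ = rec≡ , ≤-trans rec≤ (majorantRec-mono f g m y≤m)

  eval-localRec : ∀ {O n} (f : PrimRec O n) g Z Z′ m xs → Bounded m xs → (∀ x → x < majorantRec f g m m → Z x ≡ Z′ x) →
                  ∀ y → y ≤ m → eval (rec f g) Z (y ∷ xs) ≡ eval (rec f g) Z′ (y ∷ xs)
                              × eval (rec f g) Z (y ∷ xs) ≤ majorantRec f g m y
  eval-localRec f g Z Z′ m xs bounded agree zero _
    with eval-local f Z Z′ m xs bounded (λ x x< → agree x (≤-trans x< (≤-trans (m≤m+n _ m) (majorantRec-mono f g m {k′ = m} z≤n))))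
  ... | f≡ , f≤ = f≡ , ≤-trans f≤ (m≤m+n _ _)
  eval-localRec f g Z Z′ m xs bounded agree (suc y) y<m
    with eval-localRec f g Z Z′ m xs bounded agree y (<⇒≤ y<m)
  ... | prev≡ , prev≤
    with eval-local g Z Z′ (majorantRec f g m y) (y ∷ eval (rec f g) Z (y ∷ xs) ∷ xs)
           (≤-trans (<⇒≤ y<m) (majorantRec-≥ f g m y) VecAll.∷ prev≤ VecAll.∷ Bounded-mono (majorantRec-≥ f g m y) bounded)
           (λ x x< → agree x (≤-trans x< (≤-trans (m≤m+n _ _) (majorantRec-mono f g m y<m))))
  ... | g≡ , g≤ = trans g≡ (cong (λ v → eval g Z′ (y ∷ v ∷ xs)) prev≡) , ≤-trans g≤ (m≤m+n _ _)

  eval-local* : ∀ {O k n} (gs : Vec (PrimRec O n) k) Z Z′ m xs → Bounded m xs → (∀ x → x < majorant* gs m → Z x ≡ Z′ x) →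
                evalAll gs Z xs ≡ evalAll gs Z′ xs × Bounded (majorant* gs m) (evalAll gs Z xs)
  eval-local* [] Z Z′ m xs _ _ = refl , VecAll.[]
  eval-local* (g ∷ gs) Z Z′ m xs bounded agree
    with eval-local g Z Z′ m xs bounded (λ x x< → agree x (≤-trans x< (m≤m+n _ _)))
  ... | g≡ , g≤ with eval-local* gs Z Z′ m xs bounded (λ x x< → agree x (≤-trans x< (m≤n+m _ _)))
  ... | gs≡ , gs≤ = cong₂ _∷_ g≡ gs≡ , ≤-trans g≤ (m≤m+n _ _) VecAll.∷ Bounded-mono (m≤n+m _ _) gs≤

use-principle : ∀ {O} (t : PrimRec O 1) Z Z′ n → (∀ x → x < majorant t n → Z x ≡ Z′ x) →
                eval t Z (n ∷ []) ≡ eval t Z′ (n ∷ [])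
use-principle t Z Z′ n agree = proj₁ (eval-local t Z Z′ n (n ∷ []) (≤-refl VecAll.∷ VecAll.[]) agree)

-- The test on A ⊕ B built from an oracle test

module FromOracleTest (p : Bool) (T : PROracleTest) where
  open PROracleTest T

  len K L : ℕ → ℕ
  len n = eval f noOracle (n ∷ [])
  K n = len n + majorant g n
  L n = K n + K n

  accepts : ℕ → Real → Bool
  accepts n X = testBit (eval g (component (not p) X) (n ∷ [])) (code (component p X ↾ len n))

  V : ℕ → List (List Bool)
  V n = decodeSet (canonicalIndex (L n) (accepts n ∘ testBit))

  accepts-local : ∀ n X Y → (∀ i → i < L n → X i ≡ Y i) → accepts n X ≡ accepts n Y
  accepts-local n X Y agree =
    cong₂ (λ a σ → testBit a (code σ))
          (use-principle g _ _ n (λ x x< → agree _ (slot-< (not p) (<-≤-trans x< (m≤n+m _ (len n))))))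
          (↾-local _ _ (len n) (λ i i< → agree _ (slot-< p (<-≤-trans i< (m≤m+n (len n) _)))))

  accepts-⊕ : ∀ n A B → accepts n (A ⊕ B) ≡ testBit (eval g (pick (not p) A B) (n ∷ [])) (code (pick p A B ↾ len n))
  accepts-⊕ n A B =
    cong₂ (λ a σ → testBit a (code σ))
          (use-principle g _ _ n (λ x _ → ⊕-component A B (not p) x))
          (↾-local _ _ (len n) (λ i _ → ⊕-component A B p i))

  accepts-value : ∀ n τ → accepts n (testBit (value τ)) ≡ accepts n (bitAt τ)
  accepts-value n τ = accepts-local n _ _ (λ i _ → testBit-value τ i)

  lenᴾ codeᴾ oracleQueryᴾ acceptsᴾ : PrimRec false 2
  lenᴾ = comp f (proj (suc zero) ∷ [])
  codeᴾ = comp addᴾ (comp pow2ᴾ (lenᴾ ∷ []) ∷ comp (valueᴾ (componentBitᴾ p)) (lenᴾ ∷ proj zero ∷ []) ∷ [])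
  oracleQueryᴾ = comp (substOracle (componentBitᴾ (not p)) g) (proj (suc zero) ∷ proj zero ∷ [])
  acceptsᴾ = comp testBitᴾ (codeᴾ ∷ oracleQueryᴾ ∷ [])

  eval-codeᴾ : ∀ c n → eval codeᴾ noOracle (c ∷ n ∷ []) ≡ code (component p (testBit c) ↾ len n)
  eval-codeᴾ c n = begin
    eval addᴾ noOracle (eval pow2ᴾ noOracle (len n ∷ []) ∷ v ∷ [])
      ≡⟨ eval-addᴾ {false} noOracle (eval pow2ᴾ noOracle (len n ∷ [])) v ⟩
    eval pow2ᴾ noOracle (len n ∷ []) + v
      ≡⟨ cong₂ _+_ (eval-pow2ᴾ {false} noOracle (len n)) v≡ ⟩
    2 ^ len n + value (component p (testBit c) ↾ len n)
      ≡⟨ sym (code-↾ (component p (testBit c)) (len n)) ⟩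
    code (component p (testBit c) ↾ len n)
      ∎
    where
    open ≡-Reasoning
    v = eval (valueᴾ (componentBitᴾ p)) noOracle (len n ∷ c ∷ [])
    v≡ : v ≡ value (component p (testBit c) ↾ len n)
    v≡ = eval-valueᴾ (componentBitᴾ p) (component p ∘ testBit) noOracle (eval-componentBitᴾ noOracle p) (len n) c

  eval-oracleQueryᴾ : ∀ c n → eval oracleQueryᴾ noOracle (c ∷ n ∷ []) ≡ eval g (component (not p) (testBit c)) (n ∷ [])
  eval-oracleQueryᴾ c n =
    eval-substOracle (componentBitᴾ (not p)) (component (not p) ∘ testBit) noOracle
                     (eval-componentBitᴾ noOracle (not p)) g c (n ∷ [])

  eval-acceptsᴾ : ∀ c n → eval acceptsᴾ noOracle (c ∷ n ∷ []) ≡ b2n (accepts n (testBit c))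
  eval-acceptsᴾ c n =
    trans (eval-testBitᴾ {false} noOracle (eval codeᴾ noOracle (c ∷ n ∷ [])) (eval oracleQueryᴾ noOracle (c ∷ n ∷ [])))
          (cong₂ (λ i a → b2n (testBit a i)) (eval-codeᴾ c n) (eval-oracleQueryᴾ c n))

  Kᴾ Lᴾ indexᴾ : PrimRec false 1
  Kᴾ = comp addᴾ (f ∷ majorantᴾ g ∷ [])
  Lᴾ = comp addᴾ (Kᴾ ∷ Kᴾ ∷ [])
  indexᴾ = canonicalIndexᴾ Lᴾ acceptsᴾ

  eval-indexᴾ : ∀ n → eval indexᴾ noOracle (n ∷ []) ≡ canonicalIndex (L n) (accepts n ∘ testBit)
  eval-indexᴾ = eval-canonicalIndexᴾ Lᴾ acceptsᴾ noOracle L (λ n → accepts n ∘ testBit) eval-Lᴾ eval-acceptsᴾ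
    where
    eval-Kᴾ : ∀ n → eval Kᴾ noOracle (n ∷ []) ≡ K n
    eval-Kᴾ n = trans (eval-addᴾ {false} noOracle (len n) (eval (majorantᴾ g) noOracle (n ∷ [])))
                      (cong (len n +_) (eval-majorantᴾ g noOracle n))
    eval-Lᴾ : ∀ n → eval Lᴾ noOracle (n ∷ []) ≡ L n
    eval-Lᴾ n = trans (eval-addᴾ {false} noOracle (eval Kᴾ noOracle (n ∷ [])) (eval Kᴾ noOracle (n ∷ [])))
                      (cong₂ _+_ (eval-Kᴾ n) (eval-Kᴾ n))

  prefixInG : ℕ → List Bool → List Bool → Bool
  prefixInG n t o = testBit (eval g (bitAt o) (n ∷ [])) (code (bitAt t ↾ len n))

  accepts-interleave : ∀ n α β → accepts n (bitAt (interleave (K n) α β)) ≡ prefixInG n (pick p α β) (pick (not p) α β)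
  accepts-interleave n α β = begin
    accepts n (bitAt ((bitAt α ⊕ bitAt β) ↾ double (K n)))
      ≡⟨ accepts-local n _ _ (λ i i< → bitAt-↾ _ _ i (subst (i <_) (sym (double≡+ (K n))) i<)) ⟩
    accepts n (bitAt α ⊕ bitAt β)
      ≡⟨ accepts-⊕ n (bitAt α) (bitAt β) ⟩
    testBit (eval g (pick (not p) (bitAt α) (bitAt β)) (n ∷ [])) (code (pick p (bitAt α) (bitAt β) ↾ len n))
      ≡⟨ sym (cong₂ (λ O X → testBit (eval g O (n ∷ [])) (code (X ↾ len n)))
                    (pick-map bitAt (not p) α β) (pick-map bitAt p α β)) ⟩
    prefixInG n (pick p α β) (pick (not p) α β)
      ∎
    where open ≡-Reasoning

  countInG : ℕ → List Bool → ℕ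
  countInG n o = sumStrings (K n) (λ t → b2n (prefixInG n t o))

  countInG≤ : ∀ n o → countInG n o * 2 ^ n ≤ 2 ^ K n
  countInG≤ n o = begin
    countInG n o * 2 ^ n
      ≡⟨ cong (_* 2 ^ n) (sumStrings-++ (len n) (majorant g n) _ _ prefix) ⟩
    2 ^ majorant g n * sumStrings (len n) codeBit * 2 ^ n
      ≡⟨ *-assoc (2 ^ majorant g n) _ _ ⟩
    2 ^ majorant g n * (sumStrings (len n) codeBit * 2 ^ n)
      ≤⟨ *-monoʳ-≤ (2 ^ majorant g n) (sum-testBit-code≤ a n (lengths O n) (small O n)) ⟩
    2 ^ majorant g n * 2 ^ len n
      ≡⟨ *-comm (2 ^ majorant g n) _ ⟩
    2 ^ len n * 2 ^ majorant g n
      ≡⟨ sym (^-distribˡ-+-* 2 (len n) (majorant g n)) ⟩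
    2 ^ K n
      ∎
    where
    open ≤-Reasoning
    O = bitAt o
    a = eval g O (n ∷ [])
    codeBit : List Bool → ℕ
    codeBit σ = b2n (testBit a (code σ))
    prefix : ∀ σ ρ → length σ ≡ len n → b2n (prefixInG n (σ ++ ρ) o) ≡ codeBit σ
    prefix σ ρ l = cong (λ τ → b2n (testBit a (code τ))) (subst (λ m → bitAt (σ ++ ρ) ↾ m ≡ σ) l (bitAt-++-↾ σ ρ))

  sum-accepts≤ : ∀ n → sumStrings (L n) (λ τ → b2n (accepts n (bitAt τ))) * 2 ^ n ≤ 2 ^ L n
  sum-accepts≤ n = begin
    sumStrings (L n) (λ τ → b2n (accepts n (bitAt τ))) * 2 ^ n
      ≡⟨ cong (_* 2 ^ n) sum≡ ⟩
    sumStrings (K n) (countInG n) * 2 ^ n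
      ≤⟨ sumStrings-*-≤ (K n) _ (2 ^ n) (2 ^ K n) (λ o _ → countInG≤ n o) ⟩
    2 ^ K n * 2 ^ K n
      ≡⟨ sym (^-distribˡ-+-* 2 (K n) (K n)) ⟩
    2 ^ L n
      ∎
    where
    open ≤-Reasoning
    sum≡ : sumStrings (L n) (λ τ → b2n (accepts n (bitAt τ))) ≡ sumStrings (K n) (countInG n)
    sum≡ = trans (cong (λ M → sumStrings M (λ τ → b2n (accepts n (bitAt τ)))) (sym (double≡+ (K n))))
          (trans (sumStrings-interleave (K n) _)
          (trans (sumStrings-cong (K n) (λ α _ → sumStrings-cong (K n) (λ β _ → cong b2n (accepts-interleave n α β))))
                 (sumStrings-pick p (K n) (λ t o → b2n (prefixInG n t o)))))

  V-lengths : ∀ n → All (λ σ → length σ ≡ L n) (V n)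
  V-lengths n = ListAll.tabulate (λ {σ} σ∈ → proj₁ (∈-canonicalIndex⁻ (L n) _ σ σ∈))

  V-small : ∀ n → μ≤2^- (V n) n
  V-small n = sum≤⇒μ≤2^- (V n) n (V-lengths n)
    (≤-trans (*-monoˡ-≤ (2 ^ n) (sumStrings-mono (L n) covers≤accepts)) (sum-accepts≤ n))
    where
    covers≤accepts : ∀ τ → length τ ≡ L n → b2n (covers (V n) τ) ≤ b2n (accepts n (bitAt τ))
    covers≤accepts τ l = b2n-mono λ cov →
      trans (sym (accepts-value n τ)) (proj₂ (∈-canonicalIndex⁻ (L n) _ τ (covers⇒∈ (V-lengths n) l cov)))

  test : PRTest
  test = record { h = indexᴾ ; small = λ n → subst (λ i → μ≤2^- (decodeSet i) n) (sym (eval-indexᴾ n)) (V-small n) }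

  contains : ∀ A B n → pick p A B ∈[ G (pick (not p) A B) n ] → (A ⊕ B) ∈[ PRTest.G test n ]
  contains A B n ∈G with find ∈G
  ... | σ , σ∈ , σ≡ with ∈-decodeSet⇒testBit-code _ σ σ∈
  ... | inj₁ refl = ⊥-elim (μ<2^-⇒[]∉ _ n (small (pick (not p) A B) n) σ∈)
  ... | inj₂ bit = subst (λ i → (A ⊕ B) ∈[ decodeSet i ]) (sym (eval-indexᴾ n))
                         (lose τ∈ (cong ((A ⊕ B) ↾_) (sym (length-↾ (A ⊕ B) (L n)))))
    where
    τ = (A ⊕ B) ↾ L n
    σ≡′ : σ ≡ pick p A B ↾ len n
    σ≡′ = trans σ≡ (cong (pick p A B ↾_) (ListAll.lookup (lengths (pick (not p) A B) n) σ∈))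
    accepts-τ : accepts n (testBit (value τ)) ≡ true
    accepts-τ = begin
      accepts n (testBit (value τ))
        ≡⟨ accepts-value n τ ⟩
      accepts n (bitAt τ)
        ≡⟨ accepts-local n _ _ (λ i i< → bitAt-↾ (A ⊕ B) (L n) i i<) ⟩
      accepts n (A ⊕ B)
        ≡⟨ accepts-⊕ n A B ⟩
      testBit (eval g (pick (not p) A B) (n ∷ [])) (code (pick p A B ↾ len n))
        ≡⟨ cong (testBit _ ∘ code) (sym σ≡′) ⟩
      testBit (eval g (pick (not p) A B) (n ∷ [])) (code σ)
        ≡⟨ bit ⟩
      true
        ∎
      where open ≡-Reasoning
    τ∈ : τ ∈ V n
    τ∈ = ∈-canonicalIndex⁺ (L n) _ τ (length-↾ (A ⊕ B) (L n)) accepts-τ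

BPRandom-⊕⇒BPRandomRel : ∀ p A B → BPRandom (A ⊕ B) → BPRandomRel (pick p A B) (pick (not p) A B)
BPRandom-⊕⇒BPRandomRel p A B random T with random (FromOracleTest.test p T)
... | n , ∉test = n , ∉test ∘ FromOracleTest.contains p T A B n

theorem2p15 : (A B : Real) → BPRandom (A ⊕ B) → BPRandomRel A B × BPRandomRel B A
theorem2p15 A B random = BPRandom-⊕⇒BPRandomRel false A B random , BPRandom-⊕⇒BPRandomRel true A B random
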